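{- In any run of $\mathsf{OptimizedStochasticGreedy}(\epsilon,\delta)$ (with any $p\in[0,1]$) on any instance, if impression $i$ is handled in the case $|B|\ge2$ (step (4)), with chosen advertisers $a_1,a_2$, then $i$ is assigned to $a_1$ with probability at least $\frac7{18}$ and to $a_2$ with probability at least $\frac7{18}$.
   Context: Problem (online weighted bipartite matching with free disposal). A finite set $A$ of advertisers is known in advance. A finite set $I$ of $n$ impressions arrives one at a time in an arbitrary order fixed in advance; impression $i$ arrives at time $t_i\in\{1,\dots,n\}$. On arrival, nonnegative weights $w_{i,a}$ ($a\in A$) are revealed and $i$ is irrevocably assigned to one advertiser. Allocation value: $\sum_a\max_{i\in T_a}w_{i,a}$ (empty max $0$). Notation. $(x)^+=\max\{0,x\}$. $\mathrm{MaxW}_a^t$ is the maximum $w_{j,a}$ over impressions $j$ assigned to $a$ at times $\le t$ ($0$ if none). $\mathrm{Gain}_{i,a}=(w_{i,a}-\mathrm{MaxW}_a^{t_i-1})^+$; expectations are over the algorithm's randomness. Dummy impression $0$: $w_{0,a}=0$, $\mathbb{E}[\mathrm{Gain}_{0,a}]=0$. Algorithm $\mathsf{OptimizedStochasticGreedy}(\epsilon,\delta)$ with probability parameter $p\in[0,1]$. Each advertiser $a$ keeps $\mathrm{Color}(a)\in\{\mathrm{Green},\mathrm{Blue}\}$ (initially Green), $S_a$ (initially $0$), $\mathrm{index}(a)$ (initially $0$), $\mathrm{Mark}_a\in\{1,2,3\}$ (initially $3$), $\mathrm{Partner}_a$ (initially undefined). Ties broken by a fixed deterministic rule. When $i$ arrives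 at time $t$: (1) $M_i=\max_a\mathbb{E}[\mathrm{Gain}_{i,a}]$. (2) For each $a$: if $\mathrm{Color}(a)=\mathrm{Blue}$ and $w_{i,a}\ge w_{\mathrm{index}(a),a}-\delta M_i$, $\mathrm{AdaptGain}_{i,a}=\big(\mathbb{E}[\mathrm{Gain}_{\mathrm{index}(a),a}]/3-(w_{\mathrm{index}(a),a}-w_{i,a})^+/3-S_a\big)^+/12$; else $0$. (3) $B=\{a: w_{i,a}\ge w_{\mathrm{index}(a),a}-\delta M_i,\ \mathbb{E}[\mathrm{Gain}_{i,a}]+\tfrac23\mathrm{AdaptGain}_{i,a}\ge(1-\epsilon)M_i\}$; draw $u_i$ uniform on $[0,1]$ independently. (4) If $|B|\ge2$: $a_1$ maximizes $\mathbb{E}[\mathrm{Gain}_{i,a}]+\tfrac23\mathrm{AdaptGain}_{i,a}$ over $B$, $a_2$ over $B\setminus\{a_1\}$. For $a\in\{a_1,a_2\}$: $\mathrm{Color}(a)=\mathrm{Blue}$, $S_a=0$, $\mathrm{index}(a)=i$, and if $\mathrm{Partner}_a$ is defined and $\notin\{a_1,a_2\}$ set it Green. Set $\mathrm{Partner}_{a_1}=a_2$, $\mathrm{Partner}_{a_2}=a_1$. Let $\ell\in\{1,2\}$ maximize $\mathrm{AdaptGain}_{i,a_\ell}$. If $u_i>2/3$ or $\mathrm{AdaptGain}_{i,a_\ell}=0$: if $\mathrm{Mark}_{a_\ell}=1$ and $\mathrm{AdaptGain}_{i,a_\ell}>0$ assign $i$ to $a_{3-\ell}$; if $\mathrm{Mark}_{a_\ell}=2$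 and $\mathrm{AdaptGain}_{i,a_\ell}>0$ assign to $a_\ell$; if $\mathrm{Mark}_{a_\ell}=3$ or $\mathrm{AdaptGain}_{i,a_\ell}=0$ assign to $a_1$ or $a_2$ with probability $1/2$ each by a fresh coin; then $\mathrm{Mark}_{a_1}=\mathrm{Mark}_{a_2}=3$. Otherwise, if $u_i\le1/3$ assign to $a_1$, $\mathrm{Mark}_{a_1}=1,\mathrm{Mark}_{a_2}=2$; if $1/3<u_i\le2/3$ assign to $a_2$, $\mathrm{Mark}_{a_2}=1,\mathrm{Mark}_{a_1}=2$. (5) If $|B|\le1$: $B'=\{a: w_{i,a}\ge w_{\mathrm{index}(a),a}-\delta M_i,\ \mathbb{E}[\mathrm{Gain}_{i,a}]\ge(1-\epsilon)M_i\}$; $a_1=\arg\max_{a\in A}\mathbb{E}[\mathrm{Gain}_{i,a}]$. If $B'\ne\emptyset$ and $a_1\notin B'$: $a_2$ is the unique element of $B'$; with probability $p$ assign $i$ to $a_1$, with probability $1-p$ to $a_2$; add $p\,\mathbb{E}[\mathrm{Gain}_{i,a_1}]$ to $S_{a_1}$ and $(1-p)\mathbb{E}[\mathrm{Gain}_{i,a_2}]$ to $S_{a_2}$. Otherwise assign $i$ to $a_1$ and add $\mathbb{E}[\mathrm{Gain}_{i,a_1}]$ to $S_{a_1}$.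
   Formalization: The weights $w_{i,a}$ and the parameters ε, δ and p take rational values. -}

module Defs where

open import Data.Nat as ℕ using (ℕ; zero; suc)
open import Data.Fin using (Fin)
open import Data.Fin.Properties using () renaming (_≟_ to _≟ᶠ_)
open import Data.Integer using (+_)
open import Data.Rational using (ℚ; 0ℚ; 1ℚ; _+_; _*_; _-_; _⊔_; _≤_; _/_)
open import Data.Rational.Properties using (_≤?_; _≟_)
open import Data.List using (List; []; _∷_; map; foldr; length; allFin; filterᵇ; concatMap)
open import Data.Bool.ListAction using (any)
open import Data.List.Relation.Unary.All using (All)
open import Data.Bool using (Bool; true; false; if_then_else_; _∧_; _∨_; not)
open import Data.Maybe using (Maybe; just; nothing)
open import Data.Product using (_×_; _,_)
open import Relation.Nullary using (does)

pos : ℚ → ℚ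
pos x = x ⊔ 0ℚ

infix 4 _≤ᵇq_ _==q_ _==ᶠ_

_≤ᵇq_ : ℚ → ℚ → Bool
x ≤ᵇq y = does (x ≤? y)

_==q_ : ℚ → ℚ → Bool
x ==q y = does (x ≟ y)

_==ᶠ_ : ∀ {m} → Fin m → Fin m → Bool
a ==ᶠ b = does (a ≟ᶠ b)

upd : ∀ {m} {A : Set} → (Fin m → A) → Fin m → A → Fin m → A
upd f a v b = if b ==ᶠ a then v else f b

sumQ : List ℚ → ℚ
sumQ = foldr _+_ 0ℚ

third twoThirds twelfth : ℚ
third = + 1 / 3
twoThirds = + 2 / 3
twelfth = + 1 / 12

-- Advertisers are Fin m; an impression is given by its weight vector
-- (w_{i,a})_{a}.  Impressions are listed in arrival order.

Impression : ℕ → Set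
Impression m = Fin m → ℚ

NonnegInstance : ∀ {m} → List (Impression m) → Set
NonnegInstance {m} ws = All (λ w → (a : Fin m) → 0ℚ ≤ w a) ws

-- A fixed deterministic tie-breaking rule: given the time t, a tag saying
-- which arg-max is being taken (0: a₁ in step 4, 1: a₂ in step 4,
-- 2: ℓ in step 4, 3: a₁ in step 5) and the list of tied maximisers,
-- it names one of them (if it names a non-member, the first tied
-- candidate is used).
TieRule : ℕ → Set
TieRule m = ℕ → ℕ → List (Fin m) → Fin m

memb : ∀ {m} → Fin m → List (Fin m) → Bool
memb a xs = any (λ b → a ==ᶠ b) xs

argmax : ∀ {m} → TieRule m → ℕ → ℕ → (Fin m → ℚ) → List (Fin m) → Maybe (Fin m)
argmax tb t k f [] = nothing
argmax tb t k f (x ∷ xs) = just (pick (tb t k ties) ties)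
  where
  mx : ℚ
  mx = foldr (λ b r → f b ⊔ r) (f x) xs
  ties : List (Fin _)
  ties = filterᵇ (λ b → f b ==q mx) (x ∷ xs)
  pick : Fin _ → List (Fin _) → Fin _
  pick c [] = x
  pick c (y ∷ ys) = if memb c (y ∷ ys) then c else y

data Color : Set where
  green blue : Color

isBlue : Color → Bool
isBlue green = false
isBlue blue  = true

data Mark : Set where
  m1 m2 m3 : Mark

-- The part of the state that does not depend on the random choices.
-- index(a) is represented by the two quantities the algorithm ever
-- reads from it: w_{index(a),a} and E[Gain_{index(a),a}] (both 0 for
-- the dummy impression 0).
record DetState (m : ℕ) : Set where
  constructor mkDet
  field
    color   : Fin m → Color
    S       : Fin m → ℚ
    idxW    : Fin m → ℚ
    idxEG   : Fin m → ℚ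
    partner : Fin m → Maybe (Fin m)
open DetState public

-- The random part of the state: the marks and MaxW_a (the current
-- allocation matters for the future only through MaxW).
record RandState (m : ℕ) : Set where
  constructor mkRand
  field
    mark : Fin m → Mark
    maxW : Fin m → ℚ
open RandState public

Dist : ℕ → Set
Dist m = List (ℚ × RandState m)

-- Outcomes of one step: probability, advertiser receiving the impression
-- (nothing only if there are no advertisers), new random state.
Outcomes : ℕ → Set
Outcomes m = List (ℚ × Maybe (Fin m) × RandState m)

initDet : ∀ {m} → DetState m
initDet = mkDet (λ _ → green) (λ _ → 0ℚ) (λ _ → 0ℚ) (λ _ → 0ℚ) (λ _ → nothing)

initDist : ∀ {m} → Dist m
initDist = (1ℚ , mkRand (λ _ → m3) (λ _ → 0ℚ)) ∷ []

record Params (m : ℕ) : Set where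
  constructor mkParams
  field
    ε δ p : ℚ
    tie   : TieRule m
open Params public

module Step {m : ℕ} (prm : Params m) (t : ℕ) (wi : Impression m)
            (D : DetState m) (P : Dist m) where

  tb : TieRule m
  tb = tie prm

  EG : Fin m → ℚ
  EG a = sumQ (map (λ { (q , r) → q * pos (wi a - maxW r a) }) P)

  M : ℚ
  M = foldr (λ a r → EG a ⊔ r) 0ℚ (allFin m)

  elig : Fin m → Bool
  elig a = (idxW D a - δ prm * M) ≤ᵇq wi a

  AG : Fin m → ℚ
  AG a = if isBlue (color D a) ∧ elig a
         then pos (idxEG D a * third - pos (idxW D a - wi a) * third - S D a) * twelfth
         else 0ℚ

  score : Fin m → ℚ
  score a = EG a + twoThirds * AG a

  B : List (Fin m)
  B = filterᵇ (λ a → elig a ∧ ((1ℚ - ε prm) * M ≤ᵇq score a)) (allFin m)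

  choosePair : Maybe (Fin m × Fin m)
  choosePair with argmax tb t 0 score B
  ... | nothing = nothing
  ... | just a₁ with argmax tb t 1 score (filterᵇ (λ b → not (b ==ᶠ a₁)) B)
  ... | nothing = nothing
  ... | just a₂ = just (a₁ , a₂)

  -- just (a₁ , a₂) iff the impression is handled in step (4)
  case4 : Maybe (Fin m × Fin m)
  case4 = if 2 ℕ.≤ᵇ length B then choosePair else nothing

  assign : Fin m → RandState m → RandState m
  assign a r = record r { maxW = upd (maxW r) a (maxW r a ⊔ wi a) }

  module S4 (a₁ a₂ : Fin m) where
    aℓ : Fin m
    aℓ with argmax tb t 2 AG (a₁ ∷ a₂ ∷ [])
    ... | nothing = a₁
    ... | just a  = a
    aO : Fin m
    aO = if aℓ ==ᶠ a₁ then a₂ else a₁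
    agZero : Bool
    agZero = AG aℓ ==q 0ℚ

    setMarks : Mark → Mark → RandState m → RandState m
    setMarks x y r = record r { mark = upd (upd (mark r) a₁ x) a₂ y }

    -- branch "u > 2/3 or AdaptGain = 0", reached with probability q
    fallback : ℚ → RandState m → Outcomes m
    fallback q r = go (mark r aℓ) agZero
      where
      r3 = setMarks m3 m3 r
      coin : Outcomes m
      coin = (q * (+ 1 / 2) , just a₁ , assign a₁ r3)
           ∷ (q * (+ 1 / 2) , just a₂ , assign a₂ r3) ∷ []
      go : Mark → Bool → Outcomes m
      go _  true  = coin
      go m1 false = (q , just aO , assign aO r3) ∷ []
      go m2 false = (q , just aℓ , assign aℓ r3) ∷ []
      go m3 false = coin

    entry : ℚ × RandState m → Outcomes m
    entry (q , r) =
      if agZero then fallback q r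
      else (fallback (q * third) r
            Data.List.++ ((q * third , just a₁ , assign a₁ (setMarks m1 m2 r))
                         ∷ (q * third , just a₂ , assign a₂ (setMarks m2 m1 r)) ∷ []))

    outcomes : Outcomes m
    outcomes = concatMap entry P

    inPair : Fin m → Bool
    inPair b = (b ==ᶠ a₁) ∨ (b ==ᶠ a₂)

    partnerOf : Fin m → Fin m → Bool
    partnerOf a b with partner D a
    ... | nothing = false
    ... | just c  = c ==ᶠ b

    newDet : DetState m
    newDet = mkDet
      (λ b → if inPair b then blue
             else if partnerOf a₁ b ∨ partnerOf a₂ b then green else color D b)
      (upd (upd (S D) a₁ 0ℚ) a₂ 0ℚ)
      (upd (upd (idxW D) a₁ (wi a₁)) a₂ (wi a₂))
      (upd (upd (idxEG D) a₁ (EG a₁)) a₂ (EG a₂))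
      (upd (upd (partner D) a₁ (just a₂)) a₂ (just a₁))

  B' : List (Fin m)
  B' = filterᵇ (λ a → elig a ∧ ((1ℚ - ε prm) * M ≤ᵇq EG a)) (allFin m)

  step5 : DetState m × Outcomes m
  step5 with argmax tb t 3 EG (allFin m)
  ... | nothing = D , map (λ { (q , r) → (q , nothing , r) }) P
  ... | just a₁ = go B' (memb a₁ B')
    where
    single : DetState m × Outcomes m
    single = record D { S = upd (S D) a₁ (S D a₁ + EG a₁) }
           , map (λ { (q , r) → (q , just a₁ , assign a₁ r) }) P
    go : List (Fin m) → Bool → DetState m × Outcomes m
    go [] _ = single
    go (a₂ ∷ _) true = single
    go (a₂ ∷ _) false =
        record D { S = upd (upd (S D) a₁ (S D a₁ + p prm * EG a₁))
                           a₂ (S D a₂ + (1ℚ - p prm) * EG a₂) }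
      , concatMap (λ { (q , r) → (q * p prm , just a₁ , assign a₁ r)
                               ∷ (q * (1ℚ - p prm) , just a₂ , assign a₂ r) ∷ [] }) P

  result : DetState m × Outcomes m
  result with case4
  ... | just (a₁ , a₂) = S4.newDet a₁ a₂ , S4.outcomes a₁ a₂
  ... | nothing = step5

  assignProb : Fin m → ℚ
  assignProb a = sumQ (map (λ { (q , just b , _) → if b ==ᶠ a then q else 0ℚ
                              ; (q , nothing , _) → 0ℚ }) (Data.Product.proj₂ result))

forget : ∀ {m} → Outcomes m → Dist m
forget = map (λ { (q , _ , r) → (q , r) })

run : ∀ {m} → Params m → ℕ → List (Impression m) → DetState m × Dist m → DetState m × Dist m
run prm t [] st = st
run prm t (w ∷ ws) (D , P) with Step.result prm t w D P
... | (D' , O) = run prm (suc t) ws (D' , forget O)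

stateAfter : ∀ {m} → Params m → List (Impression m) → DetState m × Dist m
stateAfter prm pre = run prm 1 pre (initDet , initDist)

{-# OPTIONS --safe #-}
module Submission where

-- Call a mark neutral when it equals 3.  Throughout the run every advertiser's mark is neutral
-- with probability at least 1/3: step (5) does not touch the marks, and step (4) leaves the
-- marks outside {a₁, a₂} alone while resetting those of a₁ and a₂ to 3 on the branch u > 2/3,
-- which has probability 1/3 (or always, when AdaptGain = 0).  In step (4) with AdaptGain > 0,
-- each of a₁, a₂ receives i on its own third of [0, 2/3], and on the branch u > 2/3 it gets a
-- fair coin whenever Mark_{aℓ} = 3, which adds 1/3 · 1/2 · Pr[Mark_{aℓ} = 3] ≥ 1/18.
-- With AdaptGain = 0 the whole step is a fair coin.

open import Defs
open import Algebra.Bundles using (CommutativeMonoid)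
open import Data.Bool using (Bool; true; false; if_then_else_)
open import Data.Fin using (Fin)
open import Data.Fin.Properties using () renaming (_≟_ to _≟ᶠ_)
open import Data.Integer using (+_)
open import Data.List using (List; []; _∷_; _++_; length; map; concatMap; allFin)
open import Data.List.Properties using (map-∘; map-cong; map-cong-local)
open import Data.List.Relation.Unary.All as All using (All; []; _∷_)
open import Data.List.Relation.Unary.All.Properties using (++⁺; map⁺; concat⁺)
open import Data.Maybe using (Maybe; just; nothing)
open import Data.Nat using (ℕ; suc)
open import Data.Product using (_×_; _,_; proj₁; proj₂; uncurry)
open import Data.Rational using (ℚ; 0ℚ; 1ℚ; _≤_; _/_; _+_; _*_; _-_; nonNegative)
open import Data.Rational.Properties
open import Data.Rational.Solver using (module +-*-Solver)
open import Data.Sum using (_⊎_; inj₁; inj₂)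
open import Function using (_∘_)
open import Relation.Binary.PropositionalEquality
open import Relation.Nullary using (yes; no)
open import Relation.Nullary.Decidable using (dec-true; dec-false; from-yes)

open import Algebra.Properties.CommutativeSemigroup
  (CommutativeMonoid.commutativeSemigroup +-0-commutativeMonoid) using (interchange)

half sixth : ℚ
half  = + 1 / 2
sixth = + 1 / 6

0≤half : 0ℚ ≤ half
0≤half = from-yes (0ℚ ≤? half)

0≤third : 0ℚ ≤ third
0≤third = from-yes (0ℚ ≤? third)

0≤* : ∀ {x y} → 0ℚ ≤ x → 0ℚ ≤ y → 0ℚ ≤ x * y
0≤* {x} {y} 0≤x 0≤y =
  nonNegative⁻¹ (x * y) {{nonNeg*nonNeg⇒nonNeg x {{nonNegative 0≤x}} y {{nonNegative 0≤y}}}}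

x≤x+y : ∀ x {y} → 0ℚ ≤ y → x ≤ x + y
x≤x+y x 0≤y = ≤-trans (≤-reflexive (sym (+-identityʳ x))) (+-monoʳ-≤ x 0≤y)

x≤y+x : ∀ x {y} → 0ℚ ≤ y → x ≤ y + x
x≤y+x x {y} 0≤y = ≤-trans (x≤x+y x 0≤y) (≤-reflexive (+-comm x y))

q*third≤q : ∀ {q} → 0ℚ ≤ q → q * third ≤ q
q*third≤q {q} 0≤q = ≤-trans (*-monoˡ-≤-nonNeg q {{nonNegative 0≤q}} (from-yes (third ≤? 1ℚ)))
                            (≤-reflexive (*-identityʳ q))

if-nonneg : ∀ β {q} → 0ℚ ≤ q → 0ℚ ≤ (if β then q else 0ℚ)
if-nonneg true  0≤q = 0≤q
if-nonneg false _   = ≤-refl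

if-≤ : ∀ β {q} → 0ℚ ≤ q → (if β then q else 0ℚ) ≤ q
if-≤ true  _   = ≤-refl
if-≤ false 0≤q = 0≤q

if-split : ∀ β q p →
  (if β then q * p else 0ℚ) + ((if β then q * (1ℚ - p) else 0ℚ) + 0ℚ) ≡ (if β then q else 0ℚ)
if-split true  = solve 2 (λ q p → q :* p :+ (q :* (con 1ℚ :- p) :+ con 0ℚ) := q) refl
  where open +-*-Solver
if-split false _ _ = refl

module _ (q : ℚ) where
  open +-*-Solver

  halves : q * half + (q * half + 0ℚ) ≡ q
  halves = solve 1 (λ q → q :* con half :+ (q :* con half :+ con 0ℚ) := q) refl q

  thirds : q * third + (q * third + (q * third + 0ℚ)) ≡ q
  thirds = solve 1 (λ q → q :* con third :+ (q :* con third :+ (q :* con third :+ con 0ℚ)) := q) refl q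

  third+sixth : q * third + q * sixth ≡ q * half
  third+sixth = solve 1 (λ q → q :* con third :+ q :* con sixth := q :* con half) refl q

  sixth≡third*half : q * sixth ≡ q * third * half
  sixth≡third*half = solve 1 (λ q → q :* con sixth := q :* con third :* con half) refl q

module _ {A : Set} where

  sumBy : (A → ℚ) → List A → ℚ
  sumBy f xs = sumQ (map f xs)

  sumBy-cong : ∀ {f g : A → ℚ} {xs} → All (λ x → f x ≡ g x) xs → sumBy f xs ≡ sumBy g xs
  sumBy-cong = cong sumQ ∘ map-cong-local

  sumBy-++ : ∀ (f : A → ℚ) xs ys → sumBy f (xs ++ ys) ≡ sumBy f xs + sumBy f ys
  sumBy-++ f []       ys = sym (+-identityˡ _)
  sumBy-++ f (x ∷ xs) ys =
    trans (cong (λ s → f x + s) (sumBy-++ f xs ys)) (sym (+-assoc (f x) _ _))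

  sumBy-+ : ∀ (f g : A → ℚ) xs → sumBy (λ x → f x + g x) xs ≡ sumBy f xs + sumBy g xs
  sumBy-+ f g []       = refl
  sumBy-+ f g (x ∷ xs) =
    trans (cong (λ s → f x + g x + s) (sumBy-+ f g xs)) (interchange (f x) (g x) _ _)

  sumBy-*ʳ : ∀ (f : A → ℚ) c xs → sumBy (λ x → f x * c) xs ≡ sumBy f xs * c
  sumBy-*ʳ f c []       = sym (*-zeroˡ c)
  sumBy-*ʳ f c (x ∷ xs) =
    trans (cong (λ s → f x * c + s) (sumBy-*ʳ f c xs)) (sym (*-distribʳ-+ c (f x) _))

  sumBy-zero : ∀ xs → sumBy (λ _ → 0ℚ) xs ≡ 0ℚ
  sumBy-zero []       = refl
  sumBy-zero (x ∷ xs) = trans (+-identityˡ _) (sumBy-zero xs)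

  sumBy-mono : ∀ {f g : A → ℚ} {xs} → All (λ x → f x ≤ g x) xs → sumBy f xs ≤ sumBy g xs
  sumBy-mono []           = ≤-refl
  sumBy-mono (fx≤gx ∷ h) = +-mono-≤ fx≤gx (sumBy-mono h)

module _ {A B : Set} where

  sumBy-map : ∀ (f : B → ℚ) (g : A → B) xs → sumBy f (map g xs) ≡ sumBy (f ∘ g) xs
  sumBy-map f g xs = cong sumQ (sym (map-∘ xs))

  sumBy-concatMap : ∀ (f : B → ℚ) (g : A → List B) xs →
                    sumBy f (concatMap g xs) ≡ sumBy (sumBy f ∘ g) xs
  sumBy-concatMap f g []       = refl
  sumBy-concatMap f g (x ∷ xs) =
    trans (sumBy-++ f (g x) (concatMap g xs)) (cong (λ s → sumBy f (g x) + s) (sumBy-concatMap f g xs))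

module _ {X : Set} where

  total : List (ℚ × X) → ℚ
  total = sumBy proj₁

  Pr : (X → Bool) → List (ℚ × X) → ℚ
  Pr E = sumBy (λ (q , x) → if E x then q else 0ℚ)

  NonNeg : List (ℚ × X) → Set
  NonNeg = All (λ (q , _) → 0ℚ ≤ q)

  Pr-++ : ∀ E xs ys → Pr E (xs ++ ys) ≡ Pr E xs + Pr E ys
  Pr-++ E = sumBy-++ _

  Pr-nonneg : ∀ E {xs} → NonNeg xs → 0ℚ ≤ Pr E xs
  Pr-nonneg E {xs} nn =
    ≤-trans (≤-reflexive (sym (sumBy-zero xs))) (sumBy-mono (All.map (if-nonneg (E _)) nn))

  Pr-≤-++ : ∀ E xs {ys} → NonNeg ys → Pr E xs ≤ Pr E (xs ++ ys)
  Pr-≤-++ E xs {ys} nn = ≤-trans (x≤x+y _ (Pr-nonneg E nn)) (≤-reflexive (sym (Pr-++ E xs ys)))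

  Pr-const : ∀ E β {xs} → All (λ (_ , x) → E x ≡ β) xs → Pr E xs ≡ (if β then total xs else 0ℚ)
  Pr-const E β {xs} h =
    trans (sumBy-cong (All.map (λ {(q , _)} → cong (λ b → if b then q else 0ℚ)) h)) (by-cases β)
    where
    by-cases : ∀ β → sumBy (λ (q , _) → if β then q else 0ℚ) xs ≡ (if β then total xs else 0ℚ)
    by-cases true  = refl
    by-cases false = sumBy-zero xs

Pr-forget : ∀ {m} E (O : Outcomes m) → Pr E (forget O) ≡ Pr (E ∘ proj₂) O
Pr-forget E O = sumBy-map _ _ O

NonNeg-forget : ∀ {m} {O : Outcomes m} → NonNeg O → NonNeg (forget O)
NonNeg-forget = map⁺

neutral : Mark → Bool
neutral m3 = true
neutral _  = false

neutralAt : ∀ {m} → Fin m → RandState m → Bool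
neutralAt b r = neutral (mark r b)

receives : ∀ {m} → Fin m → Maybe (Fin m) × RandState m → Bool
receives c (just b  , _) = b ==ᶠ c
receives c (nothing , _) = false

record Invariant {m} (P : Dist m) : Set where
  field
    nonneg        : NonNeg P
    total≡1       : total P ≡ 1ℚ
    third≤neutral : ∀ b → third ≤ Pr (neutralAt b) P

initial-invariant : ∀ {m} → Invariant (initDist {m})
initial-invariant = record
  { nonneg        = from-yes (0ℚ ≤? 1ℚ) ∷ []
  ; total≡1       = refl
  ; third≤neutral = λ _ → from-yes (third ≤? 1ℚ + 0ℚ)
  }

MarksPreserved : ∀ {m} → Dist m → Dist m → Set
MarksPreserved {m} P P′ = ∀ (E : (Fin m → Mark) → Bool) → Pr (E ∘ mark) P′ ≡ Pr (E ∘ mark) P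

marksPreserved⇒invariant : ∀ {m} {P P′ : Dist m} →
  Invariant P → NonNeg P′ → MarksPreserved P P′ → Invariant P′
marksPreserved⇒invariant I nn same = record
  { nonneg        = nn
  ; total≡1       = trans (same (λ _ → true)) (Invariant.total≡1 I)
  ; third≤neutral = λ b → ≤-trans (Invariant.third≤neutral I b)
                                  (≤-reflexive (sym (same (λ mk → neutral (mk b)))))
  }

map-marksPreserved : ∀ {m} {P : Dist m} (h : ℚ × RandState m → ℚ × Maybe (Fin m) × RandState m) →
  (∀ e → proj₁ (h e) ≡ proj₁ e) → (∀ e → mark (proj₂ (proj₂ (h e))) ≡ mark (proj₂ e)) →
  NonNeg P → NonNeg (forget (map h P)) × MarksPreserved P (forget (map h P))
map-marksPreserved {P = P} h same-q same-mark nn =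
    NonNeg-forget (map⁺ (All.map (λ {e} → subst (0ℚ ≤_) (sym (same-q e))) nn))
  , λ E → trans (Pr-forget (E ∘ mark) (map h P)) (trans (sumBy-map _ h P)
            (sumBy-cong (All.universal (λ e → cong₂ (λ k q → if E k then q else 0ℚ)
                                                     (same-mark e) (same-q e)) P)))

concatMap-marksPreserved : ∀ {m} {P : Dist m} (K : ℚ × RandState m → Outcomes m) →
  (∀ {e} → 0ℚ ≤ proj₁ e → NonNeg (K e)) →
  (∀ E e → Pr (E ∘ mark ∘ proj₂) (K e) ≡ (if E (mark (proj₂ e)) then proj₁ e else 0ℚ)) →
  NonNeg P → NonNeg (forget (concatMap K P)) × MarksPreserved P (forget (concatMap K P))
concatMap-marksPreserved {P = P} K K-nonneg K-marks nn =
    NonNeg-forget (concat⁺ (map⁺ (All.map K-nonneg nn)))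
  , λ E → trans (Pr-forget (E ∘ mark) (concatMap K P))
                (trans (sumBy-concatMap _ K P) (sumBy-cong (All.universal (K-marks E) P)))

module Step5 {m} (prm : Params m) (t : ℕ) (wi : Impression m) (D : DetState m) (P : Dist m) where
  open Step prm t wi D P

  step5-marksPreserved : 0ℚ ≤ p prm → p prm ≤ 1ℚ → NonNeg P →
    NonNeg (forget (proj₂ step5)) × MarksPreserved P (forget (proj₂ step5))
  step5-marksPreserved 0≤p p≤1 nn with argmax (tie prm) t 3 EG (allFin m)
  ... | nothing = map-marksPreserved _ (λ _ → refl) (λ _ → refl) nn
  ... | just a₁ with B'
  ... | [] = map-marksPreserved _ (λ _ → refl) (λ _ → refl) nn
  ... | a₂ ∷ B′ with memb a₁ (a₂ ∷ B′)
  ... | true  = map-marksPreserved _ (λ _ → refl) (λ _ → refl) nn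
  ... | false = concatMap-marksPreserved _ (λ 0≤q → 0≤* 0≤q 0≤p ∷ 0≤* 0≤q 0≤1-p ∷ [])
                                           (λ E (q , r) → if-split (E (mark r)) q (p prm)) nn
    where
    0≤1-p : 0ℚ ≤ 1ℚ - p prm
    0≤1-p = ≤-trans (≤-reflexive (sym (+-inverseʳ (p prm)))) (+-monoˡ-≤ _ p≤1)

==ᶠ-refl : ∀ {m} (a : Fin m) → (a ==ᶠ a) ≡ true
==ᶠ-refl a = dec-true (a ≟ᶠ a) refl

upd-≡ : ∀ {m} {A : Set} (f : Fin m → A) a v → upd f a v a ≡ v
upd-≡ f a v rewrite ==ᶠ-refl a = refl

upd-≢ : ∀ {m} {A : Set} (f : Fin m → A) {a b} v → b ≢ a → upd f a v b ≡ f b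
upd-≢ f {a} {b} v b≢a rewrite dec-false (b ≟ᶠ a) b≢a = refl

module Step4 {m} (prm : Params m) (t : ℕ) (wi : Impression m) (D : DetState m) (P : Dist m)
             (a₁ a₂ : Fin m) where
  open Step prm t wi D P
  open S4 a₁ a₂

  InPair : Fin m → Set
  InPair b = b ≡ a₁ ⊎ b ≡ a₂

  inPair? : ∀ b → InPair b ⊎ (b ≢ a₁ × b ≢ a₂)
  inPair? b with b ≟ᶠ a₁ | b ≟ᶠ a₂
  ... | yes b≡a₁ | _        = inj₁ (inj₁ b≡a₁)
  ... | no  _    | yes b≡a₂ = inj₁ (inj₂ b≡a₂)
  ... | no  b≢a₁ | no  b≢a₂ = inj₂ (b≢a₁ , b≢a₂)

  reset : RandState m → RandState m
  reset = setMarks m3 m3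

  mark-reset : ∀ r {b} → InPair b → mark (reset r) b ≡ m3
  mark-reset r (inj₂ refl) = upd-≡ (upd (mark r) a₁ m3) a₂ m3
  mark-reset r (inj₁ refl) with a₁ ==ᶠ a₂
  ... | true  = refl
  ... | false = upd-≡ (mark r) a₁ m3

  mark-setMarks : ∀ x y r {b} → b ≢ a₁ → b ≢ a₂ → mark (setMarks x y r) b ≡ mark r b
  mark-setMarks x y r b≢a₁ b≢a₂ =
    trans (upd-≢ (upd (mark r) a₁ x) y b≢a₂) (upd-≢ (mark r) x b≢a₁)

  toPair : ℚ → RandState m → RandState m → Outcomes m
  toPair q r₁ r₂ = (q , just a₁ , assign a₁ r₁) ∷ (q , just a₂ , assign a₂ r₂) ∷ []

  fairCoin : ℚ → RandState m → Outcomes m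
  fairCoin q r = toPair (q * half) (reset r) (reset r)

  drawn : ℚ → RandState m → Outcomes m
  drawn q r = toPair (q * third) (setMarks m1 m2 r) (setMarks m2 m1 r)

  toPair-nonneg : ∀ {q r₁ r₂} → 0ℚ ≤ q → NonNeg (toPair q r₁ r₂)
  toPair-nonneg 0≤q = 0≤q ∷ 0≤q ∷ []

  toPair-receives : ∀ {q c} r₁ r₂ → InPair c → 0ℚ ≤ q → q ≤ Pr (receives c) (toPair q r₁ r₂)
  toPair-receives {q} r₁ r₂ (inj₁ refl) 0≤q rewrite ==ᶠ-refl a₁ =
    x≤x+y q (Pr-nonneg (receives a₁) {(q , just a₂ , assign a₂ r₂) ∷ []} (0≤q ∷ []))
  toPair-receives {q} r₁ r₂ (inj₂ refl) 0≤q rewrite ==ᶠ-refl a₂ =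
    ≤-trans (x≤x+y q ≤-refl) (x≤y+x (q + 0ℚ) (if-nonneg (a₁ ==ᶠ a₂) 0≤q))

  -- The outcomes of step (4) from a state r of weight q, with β recording whether Mark_{aℓ} = 3.
  -- With AdaptGain > 0 the draws u ≤ 2/3 give `drawn q r`, and u > 2/3 gives a `Fallback` of
  -- weight q/3: a fair coin if Mark_{aℓ} = 3, otherwise the impression goes to a fixed a.
  data Fallback (q : ℚ) (r : RandState m) : Bool → Outcomes m → Set where
    fair : Fallback q r true (fairCoin q r)
    sure : ∀ a → Fallback q r false ((q , just a , assign a (reset r)) ∷ [])

  data EntryShape (q : ℚ) (r : RandState m) (β : Bool) : Outcomes m → Set where
    no-adapt-gain : EntryShape q r β (fairCoin q r)
    adapt-gain    : ∀ {O} → Fallback (q * third) r β O → EntryShape q r β (O ++ drawn q r)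

  entry-shape : ∀ q r → EntryShape q r (neutralAt aℓ r) (entry (q , r))
  entry-shape q r with aℓ
  ... | ℓ with mark r ℓ | AG ℓ ==q 0ℚ
  ... | m1 | true  = no-adapt-gain
  ... | m2 | true  = no-adapt-gain
  ... | m3 | true  = no-adapt-gain
  ... | m1 | false = adapt-gain (sure _)
  ... | m2 | false = adapt-gain (sure _)
  ... | m3 | false = adapt-gain fair

  fallback-nonneg : ∀ {q r β O} → 0ℚ ≤ q → Fallback q r β O → NonNeg O
  fallback-nonneg 0≤q fair     = toPair-nonneg (0≤* 0≤q 0≤half)
  fallback-nonneg 0≤q (sure _) = 0≤q ∷ []

  fallback-total : ∀ {q r β O} → Fallback q r β O → total O ≡ q
  fallback-total {q} fair     = halves q
  fallback-total {q} (sure _) = +-identityʳ q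

  fallback-reset : ∀ {q r β O} → Fallback q r β O → All (λ (_ , _ , s) → mark s ≡ mark (reset r)) O
  fallback-reset fair     = refl ∷ refl ∷ []
  fallback-reset (sure _) = refl ∷ []

  fallback-neutral : ∀ {q r β O b} → InPair b → Fallback q r β O → Pr (neutralAt b ∘ proj₂) O ≡ q
  fallback-neutral {r = r} {b = b} b∈ F =
    trans (Pr-const _ true (All.map (λ eq → cong neutral (trans (cong-app eq b) (mark-reset r b∈)))
                                    (fallback-reset F)))
          (fallback-total F)

  fallback-marks-outside : ∀ {q r β O b} → b ≢ a₁ → b ≢ a₂ → Fallback q r β O →
    All (λ (_ , _ , s) → mark s b ≡ mark r b) O
  fallback-marks-outside {r = r} {b = b} b≢a₁ b≢a₂ F =
    All.map (λ eq → trans (cong-app eq b) (mark-setMarks m3 m3 r b≢a₁ b≢a₂)) (fallback-reset F)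

  fallback-receives : ∀ {q r β O c} → InPair c → 0ℚ ≤ q → Fallback q r β O →
    (if β then q * half else 0ℚ) ≤ Pr (receives c) O
  fallback-receives {r = r} c∈ 0≤q fair = toPair-receives (reset r) (reset r) c∈ (0≤* 0≤q 0≤half)
  fallback-receives {q} {r} {c = c} _ 0≤q (sure a) =
    Pr-nonneg (receives c) {(q , just a , assign a (reset r)) ∷ []} (0≤q ∷ [])

  shape-nonneg : ∀ {q r β O} → 0ℚ ≤ q → EntryShape q r β O → NonNeg O
  shape-nonneg 0≤q no-adapt-gain      = fallback-nonneg 0≤q fair
  shape-nonneg {q} 0≤q (adapt-gain F) = ++⁺ (fallback-nonneg 0≤q/3 F) (toPair-nonneg 0≤q/3)
    where
    0≤q/3 : 0ℚ ≤ q * third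
    0≤q/3 = 0≤* 0≤q 0≤third

  shape-total : ∀ {q r β O} → EntryShape q r β O → total O ≡ q
  shape-total {q} no-adapt-gain = halves q
  shape-total {q} {r} (adapt-gain {O} F) = begin
    total (O ++ drawn q r)        ≡⟨ sumBy-++ proj₁ O (drawn q r) ⟩
    total O + total (drawn q r)   ≡⟨ cong (_+ total (drawn q r)) (fallback-total F) ⟩
    q * third + total (drawn q r) ≡⟨ thirds q ⟩
    q                             ∎
    where open ≡-Reasoning

  shape-marks-outside : ∀ {q r β O b} → b ≢ a₁ → b ≢ a₂ → EntryShape q r β O →
    All (λ (_ , _ , s) → mark s b ≡ mark r b) O
  shape-marks-outside {q} {r} b≢a₁ b≢a₂ no-adapt-gain =
    fallback-marks-outside {q} {r} b≢a₁ b≢a₂ fair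
  shape-marks-outside {r = r} b≢a₁ b≢a₂ (adapt-gain F) =
    ++⁺ (fallback-marks-outside b≢a₁ b≢a₂ F)
        (mark-setMarks m1 m2 r b≢a₁ b≢a₂ ∷ mark-setMarks m2 m1 r b≢a₁ b≢a₂ ∷ [])

  shape-neutral-outside : ∀ {q r β O b} → b ≢ a₁ → b ≢ a₂ → EntryShape q r β O →
    Pr (neutralAt b ∘ proj₂) O ≡ (if neutralAt b r then q else 0ℚ)
  shape-neutral-outside {r = r} {b = b} b≢a₁ b≢a₂ S =
    trans (Pr-const _ (neutralAt b r) (All.map (cong neutral) (shape-marks-outside b≢a₁ b≢a₂ S)))
          (cong (λ T → if neutralAt b r then T else 0ℚ) (shape-total S))

  shape-neutral-inPair : ∀ {q r β O b} → InPair b → 0ℚ ≤ q → EntryShape q r β O →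
    q * third ≤ Pr (neutralAt b ∘ proj₂) O
  shape-neutral-inPair {q} {r} b∈ 0≤q no-adapt-gain =
    ≤-trans (q*third≤q 0≤q) (≤-reflexive (sym (fallback-neutral {q} {r} b∈ fair)))
  shape-neutral-inPair b∈ 0≤q (adapt-gain {O} F) =
    ≤-trans (≤-reflexive (sym (fallback-neutral b∈ F))) (Pr-≤-++ _ O (toPair-nonneg (0≤* 0≤q 0≤third)))

  shape-receives : ∀ {q r β O c} → InPair c → 0ℚ ≤ q → EntryShape q r β O →
    q * third + (if β then q else 0ℚ) * sixth ≤ Pr (receives c) O
  shape-receives {q} {r} {β} {c = c} c∈ 0≤q no-adapt-gain = begin
    q * third + (if β then q else 0ℚ) * sixth ≤⟨ +-monoʳ-≤ (q * third) q/6≤ ⟩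
    q * third + q * sixth                     ≡⟨ third+sixth q ⟩
    q * half                                  ≤⟨ fallback-receives {q} {r} c∈ 0≤q fair ⟩
    Pr (receives c) (fairCoin q r)            ∎
    where
    open ≤-Reasoning
    q/6≤ : (if β then q else 0ℚ) * sixth ≤ q * sixth
    q/6≤ = *-monoʳ-≤-nonNeg sixth (if-≤ β 0≤q)
  shape-receives {q} {r} {β} {c = c} c∈ 0≤q (adapt-gain {O} F) = begin
    q * third + (if β then q else 0ℚ) * sixth        ≡⟨ +-comm (q * third) _ ⟩
    (if β then q else 0ℚ) * sixth + q * third        ≡⟨ cong (_+ q * third) (sixth-of β) ⟩
    (if β then q * third * half else 0ℚ) + q * third ≤⟨ +-mono-≤ fallback≤ q/3≤drawn ⟩
    Pr (receives c) O + Pr (receives c) (drawn q r)  ≡⟨ sym (Pr-++ (receives c) O (drawn q r)) ⟩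
    Pr (receives c) (O ++ drawn q r)                 ∎
    where
    open ≤-Reasoning
    0≤q/3 : 0ℚ ≤ q * third
    0≤q/3 = 0≤* 0≤q 0≤third
    fallback≤ : (if β then q * third * half else 0ℚ) ≤ Pr (receives c) O
    fallback≤ = fallback-receives c∈ 0≤q/3 F
    q/3≤drawn : q * third ≤ Pr (receives c) (drawn q r)
    q/3≤drawn = toPair-receives (setMarks m1 m2 r) (setMarks m2 m1 r) c∈ 0≤q/3
    sixth-of : ∀ β → (if β then q else 0ℚ) * sixth ≡ (if β then q * third * half else 0ℚ)
    sixth-of true  = sixth≡third*half q
    sixth-of false = *-zeroˡ sixth

  Pr-outcomes : ∀ E → Pr E outcomes ≡ sumBy (Pr E ∘ entry) P
  Pr-outcomes E = sumBy-concatMap _ entry P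

  module _ (I : Invariant P) where
    open Invariant I

    outcomes-nonneg : NonNeg outcomes
    outcomes-nonneg =
      concat⁺ (map⁺ (All.map (λ {(q , r)} 0≤q → shape-nonneg 0≤q (entry-shape q r)) nonneg))

    outcomes-total : total outcomes ≡ 1ℚ
    outcomes-total = begin
      total outcomes          ≡⟨ Pr-outcomes (λ _ → true) ⟩
      sumBy (total ∘ entry) P ≡⟨ sumBy-cong (All.universal (shape-total ∘ uncurry entry-shape) P) ⟩
      total P                 ≡⟨ total≡1 ⟩
      1ℚ                      ∎
      where open ≡-Reasoning

    outcomes-third≤neutral : ∀ b → third ≤ Pr (neutralAt b ∘ proj₂) outcomes
    outcomes-third≤neutral b = ≤-trans (by-cases (inPair? b)) (≤-reflexive (sym (Pr-outcomes _)))
      where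
      open ≤-Reasoning
      by-cases : InPair b ⊎ (b ≢ a₁ × b ≢ a₂) → third ≤ sumBy (Pr (neutralAt b ∘ proj₂) ∘ entry) P
      by-cases (inj₁ b∈) = begin
        third
          ≡⟨ trans (cong (_* third) total≡1) (*-identityˡ third) ⟨
        total P * third
          ≡⟨ sumBy-*ʳ proj₁ third P ⟨
        sumBy (λ (q , _) → q * third) P
          ≤⟨ sumBy-mono (All.map (λ {(q , r)} 0≤q → shape-neutral-inPair b∈ 0≤q (entry-shape q r)) nonneg) ⟩
        sumBy (Pr (neutralAt b ∘ proj₂) ∘ entry) P
          ∎
      by-cases (inj₂ (b≢a₁ , b≢a₂)) = begin
        third
          ≤⟨ third≤neutral b ⟩
        Pr (neutralAt b) P
          ≡⟨ sumBy-cong (All.universal (λ (q , r) → shape-neutral-outside b≢a₁ b≢a₂ (entry-shape q r)) P) ⟨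
        sumBy (Pr (neutralAt b ∘ proj₂) ∘ entry) P
          ∎

    invariant : Invariant (forget outcomes)
    invariant = record
      { nonneg        = NonNeg-forget outcomes-nonneg
      ; total≡1       = trans (Pr-forget (λ _ → true) outcomes) outcomes-total
      ; third≤neutral = λ b → ≤-trans (outcomes-third≤neutral b)
                                      (≤-reflexive (sym (Pr-forget (neutralAt b) outcomes)))
      }

    7/18≤Pr-receives : ∀ {c} → InPair c → + 7 / 18 ≤ Pr (receives c) outcomes
    7/18≤Pr-receives {c} c∈ = begin
      + 7 / 18
        ≡⟨ refl ⟩
      1ℚ * third + third * sixth
        ≤⟨ +-monoʳ-≤ (1ℚ * third) (*-monoʳ-≤-nonNeg sixth (third≤neutral aℓ)) ⟩
      1ℚ * third + Pr (neutralAt aℓ) P * sixth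
        ≡⟨ cong (λ T → T * third + Pr (neutralAt aℓ) P * sixth) total≡1 ⟨
      total P * third + Pr (neutralAt aℓ) P * sixth
        ≡⟨ cong₂ _+_ (sumBy-*ʳ proj₁ third P) (sumBy-*ʳ _ sixth P) ⟨
      sumBy (λ (q , _) → q * third) P + sumBy (λ (q , r) → (if neutralAt aℓ r then q else 0ℚ) * sixth) P
        ≡⟨ sumBy-+ _ _ P ⟨
      sumBy (λ (q , r) → q * third + (if neutralAt aℓ r then q else 0ℚ) * sixth) P
        ≤⟨ sumBy-mono (All.map (λ {(q , r)} 0≤q → shape-receives c∈ 0≤q (entry-shape q r)) nonneg) ⟩
      sumBy (Pr (receives c) ∘ entry) P
        ≡⟨ Pr-outcomes (receives c) ⟨
      Pr (receives c) outcomes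
        ∎
      where open ≤-Reasoning

step-invariant : ∀ {m} (prm : Params m) t wi D P → 0ℚ ≤ p prm → p prm ≤ 1ℚ →
  Invariant P → Invariant (forget (proj₂ (Step.result prm t wi D P)))
step-invariant prm t wi D P 0≤p p≤1 I with Step.case4 prm t wi D P
... | just (a₁ , a₂) = Step4.invariant prm t wi D P a₁ a₂ I
... | nothing        = uncurry (marksPreserved⇒invariant I)
                               (Step5.step5-marksPreserved prm t wi D P 0≤p p≤1 (Invariant.nonneg I))

run-invariant : ∀ {m} (prm : Params m) t ws D P → 0ℚ ≤ p prm → p prm ≤ 1ℚ →
  Invariant P → Invariant (proj₂ (run prm t ws (D , P)))
run-invariant prm t []       D P 0≤p p≤1 I = I
run-invariant prm t (w ∷ ws) D P 0≤p p≤1 I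
  with Step.result prm t w D P | step-invariant prm t w D P 0≤p p≤1 I
... | (D′ , O) | I′ = run-invariant prm (suc t) ws D′ (forget O) 0≤p p≤1 I′

assignProb≡Pr : ∀ {m} (prm : Params m) t wi D P c →
  Step.assignProb prm t wi D P c ≡ Pr (receives c) (proj₂ (Step.result prm t wi D P))
assignProb≡Pr prm t wi D P c =
  cong sumQ (map-cong (λ { (q , just b , _) → refl ; (q , nothing , _) → refl })
                      (proj₂ (Step.result prm t wi D P)))

result-step4 : ∀ {m} (prm : Params m) t wi D P {a₁ a₂} → Step.case4 prm t wi D P ≡ just (a₁ , a₂) →
  proj₂ (Step.result prm t wi D P) ≡ Step.S4.outcomes prm t wi D P a₁ a₂
result-step4 prm t wi D P case4≡ with Step.case4 prm t wi D P
result-step4 prm t wi D P refl | just _ = refl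

lemma9 : {m : ℕ} (ε δ p : ℚ) → 0ℚ ≤ p → p ≤ 1ℚ → (tb : TieRule m)
    → (pre : List (Impression m)) (wi : Impression m) (post : List (Impression m))
    → NonnegInstance (pre ++ wi ∷ post)
    → (a₁ a₂ : Fin m)
    → Step.case4 (mkParams ε δ p tb) (suc (length pre)) wi
        (proj₁ (stateAfter (mkParams ε δ p tb) pre))
        (proj₂ (stateAfter (mkParams ε δ p tb) pre)) ≡ just (a₁ , a₂)
    → (+ 7 / 18 ≤ Step.assignProb (mkParams ε δ p tb) (suc (length pre)) wi
          (proj₁ (stateAfter (mkParams ε δ p tb) pre))
          (proj₂ (stateAfter (mkParams ε δ p tb) pre)) a₁)
      × (+ 7 / 18 ≤ Step.assignProb (mkParams ε δ p tb) (suc (length pre)) wi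
          (proj₁ (stateAfter (mkParams ε δ p tb) pre))
          (proj₂ (stateAfter (mkParams ε δ p tb) pre)) a₂)
-- The bound does not depend on the weights.
lemma9 ε δ p 0≤p p≤1 tb pre wi _ _ a₁ a₂ case4≡ = bound (inj₁ refl) , bound (inj₂ refl)
  where
  prm : Params _
  prm = mkParams ε δ p tb
  t : ℕ
  t = suc (length pre)
  D : DetState _
  D = proj₁ (stateAfter prm pre)
  P : Dist _
  P = proj₂ (stateAfter prm pre)

  bound : ∀ {c} → Step4.InPair prm t wi D P a₁ a₂ c → + 7 / 18 ≤ Step.assignProb prm t wi D P c
  bound {c} c∈ = begin
    + 7 / 18
      ≤⟨ Step4.7/18≤Pr-receives prm t wi D P a₁ a₂ I c∈ ⟩
    Pr (receives c) (Step.S4.outcomes prm t wi D P a₁ a₂)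
      ≡⟨ cong (Pr (receives c)) (result-step4 prm t wi D P case4≡) ⟨
    Pr (receives c) (proj₂ (Step.result prm t wi D P))
      ≡⟨ assignProb≡Pr prm t wi D P c ⟨
    Step.assignProb prm t wi D P c
      ∎
    where
    open ≤-Reasoning
    I : Invariant P
    I = run-invariant prm 1 pre initDet initDist 0≤p p≤1 initial-invariant
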